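{- Let $G$ be a simple graph with $\bar{\gamma}_p(G)=0$ that is not a path. Then $\kappa(G)\ge 2$; in particular, $G$ is not a tree.
   Context: $\kappa(G)$ is the vertex connectivity of $G$ (minimum number of vertices whose removal disconnects $G$). For $v\in V$, $N[v]$ is the closed neighborhood; for $S\subseteq V$, $N[S]=\bigcup_{v\in S}N[v]$. Define $\mathcal{P}^0(S)=N[S]$, $\mathcal{P}^{i+1}(S)=\mathcal{P}^i(S)\cup\{w : \{w\}=N[v]\setminus\mathcal{P}^i(S)\text{ for some } v\in\mathcal{P}^i(S)\}$, with eventual value $\mathcal{P}^\infty(S)$. $S$ is a power dominating set (PDS) if $\mathcal{P}^\infty(S)=V$, and a failed power dominating set (FPDS) otherwise. $\bar{\gamma}_p(G)$ is the maximum cardinality of an FPDS of $G$. -}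

module Defs where

open import Data.Nat using (ℕ; zero; suc; _<_; _≤_)
open import Data.Bool using (Bool; true; false)
open import Data.Fin using (Fin; toℕ)
open import Data.Fin.Subset using (Subset; _∈_; _∉_; ∣_∣; ⊥)
open import Data.Product using (Σ; ∃; _×_; _,_)
open import Data.Sum using (_⊎_)
open import Relation.Nullary using (¬_)
open import Relation.Binary.PropositionalEquality using (_≡_; _≢_)
open import Function.Definitions using (Injective)
open import Function.Bundles using (_⇔_)

record Graph (n : ℕ) : Set where
  field
    adj     : Fin n → Fin n → Bool
    symm    : ∀ u v → adj u v ≡ adj v u
    irrefl  : ∀ v → adj v v ≡ false

module _ {n : ℕ} (G : Graph n) where
  open Graph G

  InN[_] : Fin n → Fin n → Set
  InN[ v ] w = (w ≡ v) ⊎ (adj v w ≡ true)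

  InNS : Subset n → Fin n → Set
  InNS S w = Σ (Fin n) λ v → v ∈ S × InN[ v ] w

  𝒫 : Subset n → ℕ → Fin n → Set
  𝒫 S zero    w = InNS S w
  𝒫 S (suc i) w =
    𝒫 S i w ⊎
    (Σ (Fin n) λ v → 𝒫 S i v ×
      -- {w} = N[v] ∖ 𝒫^i(S)
      (InN[ v ] w × ¬ 𝒫 S i w × (∀ u → InN[ v ] u → ¬ 𝒫 S i u → u ≡ w)))

  𝒫∞ : Subset n → Fin n → Set
  𝒫∞ S w = Σ ℕ λ i → 𝒫 S i w

  IsPDS : Subset n → Set
  IsPDS S = ∀ w → 𝒫∞ S w

  IsFPDS : Subset n → Set
  IsFPDS S = ¬ IsPDS S

  FailedPowerDomNumber : ℕ → Set
  FailedPowerDomNumber k =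
    (Σ (Subset n) λ S → IsFPDS S × ∣ S ∣ ≡ k) ×
    (∀ S → IsFPDS S → ∣ S ∣ ≤ k)

  IsPath : Set
  IsPath = Σ (Fin n → Fin n) λ σ → Injective _≡_ _≡_ σ ×
    (∀ i j → (adj (σ i) (σ j) ≡ true) ⇔
             ((suc (toℕ i) ≡ toℕ j) ⊎ (suc (toℕ j) ≡ toℕ i)))

  data WalkAvoiding (X : Subset n) : Fin n → Fin n → Set where
    here : ∀ {u} → u ∉ X → WalkAvoiding X u u
    step : ∀ {u v w} → u ∉ X → adj u v ≡ true →
           WalkAvoiding X v w → WalkAvoiding X u w

  ConnectedNontrivialAfterRemoving : Subset n → Set
  ConnectedNontrivialAfterRemoving X =
    (Σ (Fin n) λ u → Σ (Fin n) λ v → u ∉ X × v ∉ X × u ≢ v) ×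
    (∀ u v → u ∉ X → v ∉ X → WalkAvoiding X u v)

  -- κ(G) ≥ k : no set of fewer than k vertices disconnects G or leaves a
  -- trivial graph (standard convention, giving κ(Kₙ) = n - 1).
  KappaAtLeast : ℕ → Set
  KappaAtLeast k = ∀ (X : Subset n) → ∣ X ∣ < k → ConnectedNontrivialAfterRemoving X

  Connected : Set
  Connected = ∀ u v → WalkAvoiding ⊥ u v

  -- a cycle of length m+3 : distinct vertices c₀,…,c_{m+2} with cᵢ ~ cᵢ₊₁
  -- (indices mod m+3)
  HasCycle : Set
  HasCycle = Σ ℕ λ m → Σ (Fin (suc (suc (suc m))) → Fin n) λ c →
    Injective _≡_ _≡_ c ×
    (∀ i j → (suc (toℕ i) ≡ toℕ j) ⊎ ((toℕ i ≡ suc (suc m)) × (toℕ j ≡ 0)) →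
             adj (c i) (c j) ≡ true)

  IsTree : Set
  IsTree = Connected × ¬ HasCycle

-- γ̄ₚ(G) = 0 says that every nonempty set, in particular every singleton {v},
-- power dominates G.  The engine is the forcing-chain lemma (ForcingChain):
-- if a region A is attached to the rest of G only through a gate of at most
-- one vertex, then at every stage the observed part of A is an induced path,
-- entered from the gate, each of whose vertices forced the next.  Applied to
--   * A = V ∖ {ℓ} with gate ℓ of degree ≤ 1 (LeafPath): the final chain,
--     preceded by ℓ, lists all of G as an induced path, so G is a path;
--     hence here every vertex has two distinct neighbours;
--   * A = the component of u in G - X, |X| ≤ 1, not containing w
--     (Separation): starting from {w}, the last vertex of the final chain has
--     degree ≤ 1, which was just excluded; so G - X is connected.
-- A vertex with two neighbours gives three vertices, so G - X has two of
-- them; and the two neighbours of y, joined by a path avoiding y, close a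
-- cycle, so G is not a tree.  Observation stages and walks are decidable,
-- so the only classical step is using ¬ ¬ IsPDS {v} to reach a contradiction.

module Submission where

open import Defs
open import Data.Nat using (ℕ; zero; suc; _+_; _∸_; _<_; _≤_; z≤n; s≤s; s≤s⁻¹; _⊔_; _≤′_; ≤′-refl; ≤′-step)
import Data.Nat.Properties as ℕ
open import Data.Bool using (true)
import Data.Bool.Properties as Bool
open import Data.Fin using (Fin; toℕ; fromℕ<) renaming (zero to fzero; suc to fsuc)
open import Data.Fin.Properties using (any?; all?; toℕ-injective; toℕ<n; toℕ-fromℕ<; pigeonhole)
  renaming (_≟_ to _≟ᶠ_)
open import Data.Fin.Subset using (Subset; _∈_; _∉_; ∣_∣; ⁅_⁆; inside; outside)
open import Data.Fin.Subset.Properties using (_∈?_; x∈⁅x⁆; x∈⁅y⁆⇒x≡y; ∣⁅x⁆∣≡1)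
open import Data.Vec using (_∷_)
open import Data.Vec.Base using (here; there)
open import Data.Product using (Σ; ∃; _×_; _,_; proj₁; proj₂)
open import Data.Sum using (_⊎_; inj₁; inj₂; swap)
open import Data.Empty using (⊥-elim)
open import Relation.Nullary using (¬_; Dec; yes; no)
open import Relation.Nullary.Decidable using (_×-dec_; _⊎-dec_; _→-dec_; ¬?; decidable-stable; toSum)
open import Relation.Binary.Definitions using (tri<; tri≈; tri>)
open import Relation.Binary.PropositionalEquality using (_≡_; _≢_; refl; sym; trans; cong; subst)
open import Function.Bundles using (_⇔_; mk⇔)

∣X∣≡0⇒x∉X : ∀ {n} (X : Subset n) → ∣ X ∣ ≡ 0 → ∀ {x} → x ∉ X
∣X∣≡0⇒x∉X (outside ∷ X) ∣X∣≡0 (there x∈X) = ∣X∣≡0⇒x∉X X ∣X∣≡0 x∈X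

∣X∣≤1⇒unique : ∀ {n} (X : Subset n) → ∣ X ∣ ≤ 1 → ∀ {a b} → a ∈ X → b ∈ X → a ≡ b
∣X∣≤1⇒unique (inside ∷ X) _ here here = refl
∣X∣≤1⇒unique (inside ∷ X) (s≤s ∣X∣≤0) here (there b∈X) =
  ⊥-elim (∣X∣≡0⇒x∉X X (ℕ.n≤0⇒n≡0 ∣X∣≤0) b∈X)
∣X∣≤1⇒unique (inside ∷ X) (s≤s ∣X∣≤0) (there a∈X) _ =
  ⊥-elim (∣X∣≡0⇒x∉X X (ℕ.n≤0⇒n≡0 ∣X∣≤0) a∈X)
∣X∣≤1⇒unique (outside ∷ X) ∣X∣≤1 (there a∈X) (there b∈X) =
  cong fsuc (∣X∣≤1⇒unique X ∣X∣≤1 a∈X b∈X)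

twoOfThreeOutside : ∀ {n} (X : Subset n) → ∣ X ∣ ≤ 1 → ∀ {a b c} → a ≢ b → a ≢ c → b ≢ c →
                    Σ (Fin n) λ u → Σ (Fin n) λ v → u ∉ X × v ∉ X × u ≢ v
twoOfThreeOutside X ∣X∣≤1 {a} {b} {c} a≢b a≢c b≢c with a ∈? X | b ∈? X
... | yes a∈X | _ = b , c , (λ b∈X → a≢b (∣X∣≤1⇒unique X ∣X∣≤1 a∈X b∈X)) ,
                            (λ c∈X → a≢c (∣X∣≤1⇒unique X ∣X∣≤1 a∈X c∈X)) , b≢c
... | no a∉X | yes b∈X = a , c , a∉X , (λ c∈X → b≢c (∣X∣≤1⇒unique X ∣X∣≤1 b∈X c∈X)) , a≢c
... | no a∉X | no b∉X  = a , b , a∉X , b∉X , a≢b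

predecessor : ∀ {j m} → j < m → ∃ λ h → m ≡ suc h
predecessor {m = suc h} _ = h , refl

commonStage : ∀ m (P : Fin m → ℕ → Set) → (∀ x {i j} → i ≤ j → P x i → P x j) →
              (∀ x → ∃ (P x)) → ∃ λ i → ∀ x → P x i
commonStage zero    P mono eventually = 0 , λ ()
commonStage (suc m) P mono eventually
  with commonStage m (λ x → P (fsuc x)) (λ x → mono (fsuc x)) (λ x → eventually (fsuc x))
     | eventually fzero
... | i , Pᵢ | j , P₀ⱼ = i ⊔ j , λ
  { fzero    → mono fzero (ℕ.m≤n⊔m i j) P₀ⱼ
  ; (fsuc x) → mono (fsuc x) (ℕ.m≤m⊔n i j) (Pᵢ x) }

extendAt : {V : Set} → (ℕ → V) → ℕ → V → ℕ → V
extendAt f k w j with j ℕ.<? k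
... | yes _ = f j
... | no _  = w

extendAt-old : {V : Set} (f : ℕ → V) (k : ℕ) (w : V) → ∀ {j} → j < k → extendAt f k w j ≡ f j
extendAt-old f k w {j} j<k with j ℕ.<? k
... | yes _   = refl
... | no j≮k  = ⊥-elim (j≮k j<k)

extendAt-new : {V : Set} (f : ℕ → V) (k : ℕ) (w : V) → extendAt f k w k ≡ w
extendAt-new f k w with k ℕ.<? k
... | yes k<k = ⊥-elim (ℕ.<-irrefl refl k<k)
... | no _    = refl

module GraphTheory {n : ℕ} (G : Graph n) where
  open Graph G

  adj-sym : ∀ {u v} → adj u v ≡ true → adj v u ≡ true
  adj-sym {u} {v} e = trans (symm v u) e

  adj⇒≢ : ∀ {u v} → adj u v ≡ true → u ≢ v
  adj⇒≢ {u} e refl with trans (sym e) (irrefl u)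
  ... | ()

  adj-cong : ∀ {a a′ b b′} → a ≡ a′ → b ≡ b′ → adj a b ≡ true → adj a′ b′ ≡ true
  adj-cong refl refl e = e

  module Walks (X : Subset n) where
    Walk : Fin n → Fin n → Set
    Walk = WalkAvoiding G X

    steps : ∀ {u w} → Walk u w → ℕ
    steps (here _)     = 0
    steps (step _ _ p) = suc (steps p)

    start∉ : ∀ {u w} → Walk u w → u ∉ X
    start∉ (here u∉X)     = u∉X
    start∉ (step u∉X _ _) = u∉X

    snoc : ∀ {u v w} → Walk u v → adj v w ≡ true → w ∉ X → Walk u w
    snoc (here v∉X)     e w∉X = step v∉X e (here w∉X)
    snoc (step u∉X e′ p) e w∉X = step u∉X e′ (snoc p e w∉X)

    record SimplePath (u w : Fin n) : Set where
      field
        L     : ℕ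
        f     : ℕ → Fin n
        f0    : f 0 ≡ u
        fL    : f L ≡ w
        adjs  : ∀ i → i < L → adj (f i) (f (suc i)) ≡ true
        out   : ∀ i → i ≤ L → f i ∉ X
        inj   : ∀ i j → i ≤ L → j ≤ L → f i ≡ f j → i ≡ j
    open SimplePath

    -- Every walk contains a simple path: prepend the first vertex to the
    -- simple path of the rest, or cut that path at the first vertex if it
    -- already passes through it.
    simplify : ∀ {u w} → Walk u w → SimplePath u w
    simplify {u} (here u∉X) = record
      { L = 0 ; f = λ _ → u ; f0 = refl ; fL = refl ; adjs = λ _ ()
      ; out = λ { zero _ → u∉X }
      ; inj = λ { zero zero _ _ _ → refl } }
    simplify {u} (step u∉X u~v rest) with simplify rest
    ... | p with ℕ.anyUpTo? (λ i → f p i ≟ᶠ u) (suc (L p))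
    ...   | yes (i , i<1+L , fi≡u) = record
            { L = L p ∸ i ; f = λ k → f p (k + i) ; f0 = fi≡u
            ; fL = trans (cong (f p) (ℕ.m∸n+n≡m i≤L)) (fL p)
            ; adjs = λ k k<L∸i → adjs p (k + i) (ℕ.m≤o∸n⇒m+n≤o (suc k) i≤L k<L∸i)
            ; out = λ k k≤L∸i → out p (k + i) (ℕ.m≤o∸n⇒m+n≤o k i≤L k≤L∸i)
            ; inj = λ a b a≤ b≤ fa≡fb → ℕ.+-cancelʳ-≡ i a b
                (inj p (a + i) (b + i) (ℕ.m≤o∸n⇒m+n≤o a i≤L a≤) (ℕ.m≤o∸n⇒m+n≤o b i≤L b≤) fa≡fb) }
      where i≤L = s≤s⁻¹ i<1+L
    ...   | no u∉p = record
            { L = suc (L p) ; f = g ; f0 = refl ; fL = fL p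
            ; adjs = gAdjs ; out = gOut ; inj = gInj }
      where
      g : ℕ → Fin n
      g zero    = u
      g (suc k) = f p k
      gAdjs : ∀ i → i < suc (L p) → adj (g i) (g (suc i)) ≡ true
      gAdjs zero    _         = adj-cong refl (sym (f0 p)) u~v
      gAdjs (suc i) (s≤s i<L) = adjs p i i<L
      gOut : ∀ i → i ≤ suc (L p) → g i ∉ X
      gOut zero    _         = u∉X
      gOut (suc i) (s≤s i≤L) = out p i i≤L
      gInj : ∀ a b → a ≤ suc (L p) → b ≤ suc (L p) → g a ≡ g b → a ≡ b
      gInj zero    zero    _         _         _ = refl
      gInj zero    (suc b) _         (s≤s b≤L) e = ⊥-elim (u∉p (b , s≤s b≤L , sym e))
      gInj (suc a) zero    (s≤s a≤L) _         e = ⊥-elim (u∉p (a , s≤s a≤L , e))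
      gInj (suc a) (suc b) (s≤s a≤L) (s≤s b≤L) e = cong suc (inj p a b a≤L b≤L e)

    length<n : ∀ {u w} (p : SimplePath u w) → L p < n
    length<n p with n ℕ.≤? L p
    ... | no n≰L = ℕ.≰⇒> n≰L
    ... | yes n≤L with pigeonhole (s≤s n≤L) (λ i → f p (toℕ i))
    ...   | i , j , i<j , fi≡fj = ⊥-elim (ℕ.<⇒≢ i<j
            (inj p _ _ (s≤s⁻¹ (toℕ<n i)) (s≤s⁻¹ (toℕ<n j)) fi≡fj))

    walkAlong : ∀ L (f : ℕ → Fin n) → (∀ i → i < L → adj (f i) (f (suc i)) ≡ true) →
                (∀ i → i ≤ L → f i ∉ X) → ∀ {u w} → f 0 ≡ u → f L ≡ w →
                Σ (Walk u w) λ q → steps q ≡ L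
    walkAlong zero    f adjs out refl refl = here (out 0 z≤n) , refl
    walkAlong (suc L) f adjs out refl fL
      with walkAlong L (λ i → f (suc i)) (λ i i<L → adjs (suc i) (s≤s i<L))
                     (λ i i≤L → out (suc i) (s≤s i≤L)) refl fL
    ... | q , q≡L = step (out 0 z≤n) (adjs 0 (s≤s z≤n)) q , cong suc q≡L

    shortWalk : ∀ {u w} → Walk u w → Σ (Walk u w) λ q → steps q ≤ n
    shortWalk p with simplify p
    ... | sp with walkAlong (L sp) (f sp) (adjs sp) (out sp) (f0 sp) (fL sp)
    ... | q , q≡L = q , subst (_≤ n) (sym q≡L) (ℕ.<⇒≤ (length<n sp))

    reach? : ∀ k u w → Dec (Σ (Walk u w) λ p → steps p ≤ k)
    reach? k u w with u ∈? X | u ≟ᶠ w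
    ... | yes u∈X | _        = no λ (p , _) → start∉ p u∈X
    ... | no u∉X  | yes refl = yes (here u∉X , z≤n)
    reach? zero    u w | no _   | no u≢w = no λ { (here _ , _) → u≢w refl ; (step _ _ _ , ()) }
    reach? (suc k) u w | no u∉X | no u≢w
      with any? (λ v → (adj u v Bool.≟ true) ×-dec reach? k v w)
    ... | yes (v , u~v , p , p≤k) = yes (step u∉X u~v p , s≤s p≤k)
    ... | no none = no λ { (here _ , _) → u≢w refl
                         ; (step _ u~v p , s≤s p≤k) → none (_ , u~v , p , p≤k) }

    walk? : ∀ u w → Dec (Walk u w)
    walk? u w with reach? n u w
    ... | yes (p , _) = yes p
    ... | no none     = no λ p → none (shortWalk p)

  Deg≤1 : Fin n → Set
  Deg≤1 y = ∀ p q → adj y p ≡ true → adj y q ≡ true → p ≡ q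

  twoNeighbours? : ∀ y → (∃ λ p → ∃ λ q → p ≢ q × adj y p ≡ true × adj y q ≡ true) ⊎ Deg≤1 y
  twoNeighbours? y
    with any? (λ p → any? λ q → ¬? (p ≟ᶠ q) ×-dec (adj y p Bool.≟ true) ×-dec (adj y q Bool.≟ true))
  ... | yes (p , q , two) = inj₁ (p , q , two)
  ... | no none = inj₂ λ p q y~p y~q → decidable-stable (p ≟ᶠ q) λ p≢q → none (p , q , p≢q , y~p , y~q)

  InN? : ∀ v w → Dec (InN[ G ] v w)
  InN? v w = (w ≟ᶠ v) ⊎-dec (adj v w Bool.≟ true)

  𝒫? : ∀ S i w → Dec (𝒫 G S i w)
  𝒫? S zero    w = any? λ v → (v ∈? S) ×-dec InN? v w
  𝒫? S (suc i) w = 𝒫? S i w ⊎-dec any? λ v →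
    𝒫? S i v ×-dec InN? v w ×-dec ¬? (𝒫? S i w) ×-dec
    all? λ u → InN? v u →-dec (¬? (𝒫? S i u) →-dec (u ≟ᶠ w))

  𝒫-mono : ∀ S {i j w} → i ≤ j → 𝒫 G S i w → 𝒫 G S j w
  𝒫-mono S {i} {w = w} i≤j p = go (ℕ.≤⇒≤′ i≤j)
    where
    go : ∀ {j} → i ≤′ j → 𝒫 G S j w
    go ≤′-refl        = p
    go (≤′-step i≤′j) = inj₁ (go i≤′j)

  pdsStage : ∀ S → IsPDS G S → ∃ λ i → ∀ w → 𝒫 G S i w
  pdsStage S pds = commonStage n (λ w i → 𝒫 G S i w) (λ w → 𝒫-mono S) pds

  -- Fix an initial set S, a gate X (at most one vertex) and
  -- a region A all of whose neighbours lie in A ∪ X.  Then at every stage the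
  -- observed part of A is a chain f 0, …, f (k-1): an induced path entered
  -- from the gate, in which each vertex has forced the next.
  module ForcingChain (S : Subset n) (X A : Fin n → Set) (A? : ∀ z → Dec (A z))
                      (A-closed : ∀ a z → A a → adj a z ≡ true → A z ⊎ X z)
                      (X-unique : ∀ x y → X x → X y → x ≡ y) where

    EnteredAt : (ℕ → Fin n) → Set
    EnteredAt f = (∀ x z → X x → A z → adj x z ≡ true → z ≡ f 0) × (∃ λ x → X x × adj x (f 0) ≡ true)

    record Chain : Set where
      field
        k     : ℕ
        f     : ℕ → Fin n
        inA   : ∀ i → i < k → A (f i)
        dist  : ∀ i j → i < k → j < k → f i ≡ f j → i ≡ j
        cons  : ∀ i → suc i < k → adj (f i) (f (suc i)) ≡ true
        nbr   : ∀ i → suc i < k → ∀ z → A z → adj (f i) z ≡ true →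
                ∃ λ j → j ≤ suc i × f j ≡ z
        entry : 0 < k → EnteredAt f
    open Chain public

    _∈C_ : Fin n → Chain → Set
    a ∈C c = ∃ λ j → j < k c × f c j ≡ a

    Tracks : ℕ → Chain → Set
    Tracks i c = ∀ a → A a → (𝒫 G S i a → a ∈C c) × (a ∈C c → 𝒫 G S i a)

    -- the chain listing nothing (v is an irrelevant filler)
    emptyChain : Fin n → Chain
    emptyChain v = record { k = 0 ; f = λ _ → v ; inA = λ _ () ; dist = λ _ _ () ;
                            cons = λ _ () ; nbr = λ _ () ; entry = λ () }

    induced : ∀ c i j → suc i < j → j < k c → adj (f c i) (f c j) ≢ true
    induced c i j i+1<j j<k e with nbr c i (ℕ.<-trans i+1<j j<k) (f c j) (inA c j j<k) e
    ... | j′ , j′≤i+1 , fj′≡fj =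
      ℕ.<⇒≱ i+1<j (subst (_≤ suc i) j′≡j j′≤i+1)
      where
      j′≡j : j′ ≡ j
      j′≡j = dist c j′ j (ℕ.≤-<-trans j′≤i+1 (ℕ.<-trans i+1<j j<k)) j<k fj′≡fj

    -- The vertices that may force into A: the last chain vertex, or the gate
    -- while the chain is empty.
    Frontier : Chain → Fin n → Set
    Frontier c g = (∃ λ h → k c ≡ suc h × f c h ≡ g) ⊎ (k c ≡ 0 × X g)

    frontier-unique : ∀ c {g g′} → Frontier c g → Frontier c g′ → g ≡ g′
    frontier-unique c (inj₁ (h , k≡h+1 , fh≡g)) (inj₁ (h′ , k≡h′+1 , fh′≡g′))
      with ℕ.suc-injective (trans (sym k≡h+1) k≡h′+1)
    ... | refl = trans (sym fh≡g) fh′≡g′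
    frontier-unique c (inj₁ (_ , k≡h+1 , _)) (inj₂ (k≡0 , _)) with trans (sym k≡h+1) k≡0
    ... | ()
    frontier-unique c (inj₂ (k≡0 , _)) (inj₁ (_ , k≡h+1 , _)) with trans (sym k≡h+1) k≡0
    ... | ()
    frontier-unique c (inj₂ (_ , Xg)) (inj₂ (_ , Xg′)) = X-unique _ _ Xg Xg′

    -- Whatever forces a new vertex w of A lies on the frontier: an earlier
    -- chain vertex, or the gate of a nonempty chain, has w observed already.
    forcer-frontier : ∀ {i} c → Tracks i c → ∀ {g w} → A w → ¬ 𝒫 G S i w →
                      𝒫 G S i g → adj g w ≡ true → Frontier c g
    forcer-frontier c tr {g} {w} Aw w∉ g∈ g~w with A-closed w g Aw (adj-sym g~w)
    ... | inj₁ Ag = fromIndex (proj₁ (tr g Ag) g∈)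
      where
      fromIndex : g ∈C c → Frontier c g
      fromIndex (j , j<k , fj≡g) with suc j ℕ.<? k c
      ... | no j+1≮k = inj₁ (j , ℕ.≤-antisym (ℕ.≮⇒≥ j+1≮k) j<k , fj≡g)
      ... | yes j+1<k with nbr c j j+1<k w Aw (adj-cong (sym fj≡g) refl g~w)
      ...   | j′ , j′≤j+1 , fj′≡w = ⊥-elim (w∉ (proj₂ (tr w Aw) (j′ , ℕ.≤-<-trans j′≤j+1 j+1<k , fj′≡w)))
    ... | inj₂ Xg with k c in k≡
    ...   | zero  = inj₂ (refl , Xg)
    ...   | suc _ = ⊥-elim (w∉ (proj₂ (tr w Aw)
                      (0 , s≤s z≤n ,
                       sym (proj₁ (entry c (subst (0 <_) (sym k≡) (s≤s z≤n))) g w Xg Aw g~w))))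

    newcomer-unique : ∀ {i} c → Tracks i c → ∀ {g w} → Frontier c g →
                      (∀ u → InN[ G ] g u → ¬ 𝒫 G S i u → u ≡ w) →
                      ∀ a → A a → 𝒫 G S (suc i) a → ¬ 𝒫 G S i a → a ≡ w
    newcomer-unique c tr fr forced a Aa (inj₁ a∈) a∉ = ⊥-elim (a∉ a∈)
    newcomer-unique c tr fr forced a Aa (inj₂ (g′ , g′∈ , inj₁ a≡g′ , _)) a∉ =
      ⊥-elim (a∉ (subst (𝒫 G S _) (sym a≡g′) g′∈))
    newcomer-unique c tr fr forced a Aa (inj₂ (g′ , g′∈ , inj₂ g′~a , _)) a∉ =
      forced a (inj₂ (adj-cong (frontier-unique c (forcer-frontier c tr Aa a∉ g′∈ g′~a) fr) refl g′~a)) a∉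

    module Extend {i} (c : Chain) (tr : Tracks i c) {g w : Fin n} (fr : Frontier c g)
                  (g∈ : 𝒫 G S i g) (g~w : adj g w ≡ true) (Aw : A w) (w∉ : ¬ 𝒫 G S i w)
                  (forced : ∀ u → InN[ G ] g u → ¬ 𝒫 G S i u → u ≡ w) where
      K : ℕ
      K = k c

      F : ℕ → Fin n
      F = extendAt (f c) K w

      F-old : ∀ {j} → j < K → F j ≡ f c j
      F-old = extendAt-old (f c) K w

      F-new : F K ≡ w
      F-new = extendAt-new (f c) K w

      position : ∀ {j} → j < suc K → j < K ⊎ j ≡ K
      position j<1+K = ℕ.m≤n⇒m<n∨m≡n (s≤s⁻¹ j<1+K)

      w∉c : ∀ {j} → j < K → f c j ≢ w
      w∉c j<K fj≡w = w∉ (proj₂ (tr w Aw) (_ , j<K , fj≡w))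

      last≡g : ∀ {j} → suc j ≡ K → f c j ≡ g
      last≡g = lastOf fr
        where
        lastOf : Frontier c g → ∀ {j} → suc j ≡ K → f c j ≡ g
        lastOf (inj₁ (h , K≡h+1 , fh≡g)) j+1≡K with ℕ.suc-injective (trans j+1≡K K≡h+1)
        ... | refl = fh≡g
        lastOf (inj₂ (K≡0 , _)) j+1≡K with trans j+1≡K K≡0
        ... | ()

      inA′ : ∀ j → j < suc K → A (F j)
      inA′ j j<1+K with position j<1+K
      ... | inj₁ j<K  = subst A (sym (F-old j<K)) (inA c j j<K)
      ... | inj₂ refl = subst A (sym F-new) Aw

      dist′ : ∀ a b → a < suc K → b < suc K → F a ≡ F b → a ≡ b
      dist′ a b a<1+K b<1+K Fa≡Fb with position a<1+K | position b<1+K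
      ... | inj₁ a<K  | inj₁ b<K  = dist c a b a<K b<K (trans (sym (F-old a<K)) (trans Fa≡Fb (F-old b<K)))
      ... | inj₁ a<K  | inj₂ refl = ⊥-elim (w∉c a<K (trans (sym (F-old a<K)) (trans Fa≡Fb F-new)))
      ... | inj₂ refl | inj₁ b<K  = ⊥-elim (w∉c b<K (trans (sym (F-old b<K)) (trans (sym Fa≡Fb) F-new)))
      ... | inj₂ refl | inj₂ refl = refl

      cons′ : ∀ j → suc j < suc K → adj (F j) (F (suc j)) ≡ true
      cons′ j j+1<1+K with position j+1<1+K
      ... | inj₁ j+1<K =
        adj-cong (sym (F-old (ℕ.<-trans (ℕ.n<1+n j) j+1<K))) (sym (F-old j+1<K)) (cons c j j+1<K)
      ... | inj₂ j+1≡K =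
        adj-cong (sym (trans (F-old (subst (j <_) j+1≡K (ℕ.n<1+n j))) (last≡g j+1≡K)))
                 (sym (trans (cong F j+1≡K) F-new)) g~w

      -- the new inner vertex g has all A-neighbours observed except w
      nbr′ : ∀ j → suc j < suc K → ∀ z → A z → adj (F j) z ≡ true → ∃ λ j′ → j′ ≤ suc j × F j′ ≡ z
      nbr′ j j+1<1+K z Az Fj~z with position j+1<1+K
      ... | inj₁ j+1<K with nbr c j j+1<K z Az (adj-cong (F-old (ℕ.<-trans (ℕ.n<1+n j) j+1<K)) refl Fj~z)
      ...   | j′ , j′≤j+1 , fj′≡z = j′ , j′≤j+1 , trans (F-old (ℕ.≤-<-trans j′≤j+1 j+1<K)) fj′≡z
      nbr′ j j+1<1+K z Az Fj~z | inj₂ j+1≡K with 𝒫? S i z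
      ... | yes z∈ with proj₁ (tr z Az) z∈
      ...   | j′ , j′<K , fj′≡z = j′ , subst (j′ ≤_) (sym j+1≡K) (ℕ.<⇒≤ j′<K) , trans (F-old j′<K) fj′≡z
      nbr′ j j+1<1+K z Az Fj~z | inj₂ j+1≡K | no z∉ =
        suc j , ℕ.≤-refl , trans (cong F j+1≡K) (trans F-new (sym (forced z (inj₂ g~z) z∉)))
        where
        g~z : adj g z ≡ true
        g~z = adj-cong (trans (F-old (subst (j <_) j+1≡K (ℕ.n<1+n j))) (last≡g j+1≡K)) refl Fj~z

      entry′ : 0 < suc K → EnteredAt F
      entry′ _ = entryOf fr
        where
        entryOf : Frontier c g → EnteredAt F
        entryOf (inj₁ (h , K≡h+1 , _)) =
          let 0<K = subst (0 <_) (sym K≡h+1) (s≤s z≤n)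
              (onlyF0 , x , Xx , x~f0) = entry c 0<K
          in (λ x z Xx Az x~z → trans (onlyF0 x z Xx Az x~z) (sym (F-old 0<K))) ,
             (x , Xx , adj-cong refl (sym (F-old 0<K)) x~f0)
        entryOf (inj₂ (K≡0 , Xg)) = gateOnlyToW , (g , Xg , adj-cong refl (sym F0≡w) g~w)
          where
          F0≡w : F 0 ≡ w
          F0≡w = trans (cong F (sym K≡0)) F-new
          gateOnlyToW : ∀ x z → X x → A z → adj x z ≡ true → z ≡ F 0
          gateOnlyToW x z Xx Az x~z =
            trans (forced z (inj₂ (adj-cong (X-unique x g Xx Xg) refl x~z)) z∉) (sym F0≡w)
            where
            z∉ : ¬ 𝒫 G S i z
            z∉ z∈ with proj₁ (tr z Az) z∈
            ... | _ , j<K , _ = ℕ.n≮0 (subst (_ <_) K≡0 j<K)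

      extended : Chain
      extended = record { k = suc K ; f = F ; inA = inA′ ; dist = dist′ ; cons = cons′ ;
                          nbr = nbr′ ; entry = entry′ }

      tracks : Tracks (suc i) extended
      tracks a Aa = observed⇒listed , listed⇒observed
        where
        observed⇒listed : 𝒫 G S (suc i) a → a ∈C extended
        observed⇒listed a∈ with 𝒫? S i a
        ... | yes a∈ᵢ with proj₁ (tr a Aa) a∈ᵢ
        ...   | j , j<K , fj≡a = j , ℕ.<-trans j<K (ℕ.n<1+n K) , trans (F-old j<K) fj≡a
        observed⇒listed a∈ | no a∉ =
          K , ℕ.n<1+n K , trans F-new (sym (newcomer-unique c tr fr forced a Aa a∈ a∉))
        listed⇒observed : a ∈C extended → 𝒫 G S (suc i) a
        listed⇒observed (j , j<1+K , Fj≡a) with position j<1+K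
        ... | inj₁ j<K  = inj₁ (proj₂ (tr a Aa) (j , j<K , trans (sym (F-old j<K)) Fj≡a))
        ... | inj₂ refl =
          subst (𝒫 G S (suc i)) (trans (sym F-new) Fj≡a) (inj₂ (g , g∈ , inj₂ g~w , w∉ , forced))

    nextStage : ∀ {i} c → Tracks i c → Σ Chain (Tracks (suc i))
    nextStage {i} c tr with any? (λ w → A? w ×-dec 𝒫? S (suc i) w ×-dec ¬? (𝒫? S i w))
    ... | no none =
      c , λ a Aa → (λ a∈ → proj₁ (tr a Aa) (unchanged a Aa a∈)) , (λ a∈c → inj₁ (proj₂ (tr a Aa) a∈c))
      where
      unchanged : ∀ a → A a → 𝒫 G S (suc i) a → 𝒫 G S i a
      unchanged a Aa a∈ = decidable-stable (𝒫? S i a) λ a∉ → none (a , Aa , a∈ , a∉)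
    ... | yes (w , Aw , inj₁ w∈ , w∉) = ⊥-elim (w∉ w∈)
    ... | yes (w , Aw , inj₂ (g , g∈ , inj₁ w≡g , _) , w∉) = ⊥-elim (w∉ (subst (𝒫 G S i) (sym w≡g) g∈))
    ... | yes (w , Aw , inj₂ (g , g∈ , inj₂ g~w , _ , forced) , w∉) =
      Extend.extended c tr fr g∈ g~w Aw w∉ forced , Extend.tracks c tr fr g∈ g~w Aw w∉ forced
      where
      fr : Frontier c g
      fr = forcer-frontier c tr Aw w∉ g∈ g~w

    tracksAt : ∀ c₀ → Tracks 0 c₀ → ∀ i → Σ Chain (Tracks i)
    tracksAt c₀ tr₀ zero    = c₀ , tr₀
    tracksAt c₀ tr₀ (suc i) = let (c , tr) = tracksAt c₀ tr₀ i in nextStage c tr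

    -- Once every vertex is observed, the last chain vertex f h has at most
    -- one neighbour: its predecessor, or the gate when h = 0.
    endpoint-deg≤1 : ∀ {i} c → Tracks i c → (∀ z → 𝒫 G S i z) → ∀ h → k c ≡ suc h → Deg≤1 (f c h)
    endpoint-deg≤1 c tr all h k≡h+1 p q fh~p fh~q = behind-unique (behind p fh~p) (behind q fh~q)
      where
      h<k : h < k c
      h<k = subst (h <_) (sym k≡h+1) (ℕ.n<1+n h)

      0<k : 0 < k c
      0<k = ℕ.≤-<-trans z≤n h<k

      Behind : Fin n → Set
      Behind z = (h ≡ 0 × X z) ⊎ (∃ λ h′ → h ≡ suc h′ × z ≡ f c h′)

      -- a listed neighbour of f h sits just before it, as the chain is induced
      listedNeighbour : ∀ z → adj (f c h) z ≡ true → ∀ j → j < k c → f c j ≡ z → suc j ≡ h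
      listedNeighbour z fh~z j j<k fj≡z with ℕ.<-cmp (suc j) h
      ... | tri≈ _ j+1≡h _ = j+1≡h
      ... | tri< j+1<h _ _ = ⊥-elim (induced c j h j+1<h h<k (adj-cong (sym fj≡z) refl (adj-sym fh~z)))
      ... | tri> _ _ h<j+1 = ⊥-elim (adj⇒≢ fh~z (trans (cong (f c) (sym j≡h)) fj≡z))
        where
        j≡h : j ≡ h
        j≡h = ℕ.≤-antisym (s≤s⁻¹ (subst (j <_) k≡h+1 j<k)) (s≤s⁻¹ h<j+1)

      behind : ∀ z → adj (f c h) z ≡ true → Behind z
      behind z fh~z with A-closed (f c h) z (inA c h h<k) fh~z
      ... | inj₂ Xz =
        inj₁ (dist c h 0 h<k 0<k (proj₁ (entry c 0<k) z (f c h) Xz (inA c h h<k) (adj-sym fh~z)) , Xz)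
      ... | inj₁ Az with proj₁ (tr z Az) (all z)
      ...   | j , j<k , fj≡z = inj₂ (j , sym (listedNeighbour z fh~z j j<k fj≡z) , sym fj≡z)

      behind-unique : ∀ {p q} → Behind p → Behind q → p ≡ q
      behind-unique (inj₁ (_ , Xp)) (inj₁ (_ , Xq)) = X-unique _ _ Xp Xq
      behind-unique (inj₁ (refl , _)) (inj₂ (_ , () , _))
      behind-unique (inj₂ (_ , refl , _)) (inj₁ (() , _))
      behind-unique (inj₂ (h₁ , h≡h₁+1 , p≡fh₁)) (inj₂ (h₂ , h≡h₂+1 , q≡fh₂))
        with ℕ.suc-injective (trans (sym h≡h₁+1) h≡h₂+1)
      ... | refl = trans p≡fh₁ (sym q≡fh₂)

    -- If S power dominates G, a nonempty region A contains a vertex of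
    -- degree at most one: the end of the final chain.
    lowDegreeVertex : ∀ c₀ → Tracks 0 c₀ → IsPDS G S → ∀ u → A u → ∃ Deg≤1
    lowDegreeVertex c₀ tr₀ pds u Au with pdsStage S pds
    ... | i , all with tracksAt c₀ tr₀ i
    ...   | c , tr with proj₁ (tr u Au) (all u)
    ...     | _ , j<k , _ with predecessor j<k
    ...       | h , k≡h+1 = f c h , endpoint-deg≤1 c tr all h k≡h+1

  listing⇒path : ∀ K (g : ℕ → Fin n) →
                 (∀ v → ∃ λ m → m ≤ K × g m ≡ v) →
                 (∀ a b → a ≤ K → b ≤ K → g a ≡ g b → a ≡ b) →
                 (∀ a → suc a ≤ K → adj (g a) (g (suc a)) ≡ true) →
                 (∀ a b → b ≤ K → suc a < b → adj (g a) (g b) ≢ true) →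
                 IsPath G
  listing⇒path K g cover g-inj consecutive gaps =
    (λ i → g (toℕ i)) , (λ {i} {j} e → toℕ-injective (g-inj _ _ (bound i) (bound j) e)) ,
    λ i j → adjacent⇔consecutive (toℕ i) (toℕ j) (bound i) (bound j)
    where
    index : Fin n → Fin (suc K)
    index v = fromℕ< (s≤s (proj₁ (proj₂ (cover v))))

    g∘index : ∀ v → g (toℕ (index v)) ≡ v
    g∘index v = trans (cong g (toℕ-fromℕ< (s≤s (proj₁ (proj₂ (cover v)))))) (proj₂ (proj₂ (cover v)))

    n≤1+K : n ≤ suc K
    n≤1+K with n ℕ.≤? suc K
    ... | yes n≤1+K = n≤1+K
    ... | no n≰1+K with pigeonhole (ℕ.≰⇒> n≰1+K) index
    ...   | a , b , a<b , ia≡ib =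
      ⊥-elim (ℕ.<⇒≢ a<b (cong toℕ (trans (sym (g∘index a)) (trans (cong (λ m → g (toℕ m)) ia≡ib) (g∘index b)))))

    bound : ∀ (i : Fin n) → toℕ i ≤ K
    bound i = s≤s⁻¹ (ℕ.≤-trans (toℕ<n i) n≤1+K)

    adjacent⇔consecutive : ∀ a b → a ≤ K → b ≤ K →
                           (adj (g a) (g b) ≡ true) ⇔ ((suc a ≡ b) ⊎ (suc b ≡ a))
    adjacent⇔consecutive a b a≤K b≤K = mk⇔ toConsecutive fromConsecutive
      where
      forward : ∀ a b → b ≤ K → a < b → adj (g a) (g b) ≡ true → suc a ≡ b
      forward a b b≤K a<b e with ℕ.<-cmp (suc a) b
      ... | tri≈ _ a+1≡b _ = a+1≡b
      ... | tri< a+1<b _ _ = ⊥-elim (gaps a b b≤K a+1<b e)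
      ... | tri> _ _ b<a+1 = ⊥-elim (ℕ.<⇒≱ b<a+1 a<b)
      toConsecutive : adj (g a) (g b) ≡ true → (suc a ≡ b) ⊎ (suc b ≡ a)
      toConsecutive e with ℕ.<-cmp a b
      ... | tri< a<b _ _ = inj₁ (forward a b b≤K a<b e)
      ... | tri≈ _ refl _ = ⊥-elim (adj⇒≢ e refl)
      ... | tri> _ _ b<a = inj₂ (forward b a a≤K b<a (adj-sym e))
      fromConsecutive : (suc a ≡ b) ⊎ (suc b ≡ a) → adj (g a) (g b) ≡ true
      fromConsecutive (inj₁ refl) = consecutive a b≤K
      fromConsecutive (inj₂ refl) = adj-sym (consecutive b a≤K)

  -- A vertex ℓ of degree at most one that power dominates G is an end of a
  -- path through all of G: with gate ℓ and region V ∖ {ℓ}, the final chain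
  -- preceded by ℓ lists every vertex.
  module LeafPath (ℓ : Fin n) (ℓ-deg≤1 : Deg≤1 ℓ) where
    open ForcingChain ⁅ ℓ ⁆ (_≡ ℓ) (_≢ ℓ) (λ z → ¬? (z ≟ᶠ ℓ)) (λ _ z _ _ → swap (toSum (z ≟ᶠ ℓ)))
                      (λ x y x≡ℓ y≡ℓ → trans x≡ℓ (sym y≡ℓ))

    stage0 : ∀ a → a ≢ ℓ → 𝒫 G ⁅ ℓ ⁆ 0 a → adj ℓ a ≡ true
    stage0 a a≢ℓ (v , v∈ , inj₁ a≡v) = ⊥-elim (a≢ℓ (trans a≡v (x∈⁅y⁆⇒x≡y ℓ v∈)))
    stage0 a a≢ℓ (v , v∈ , inj₂ v~a) = adj-cong (x∈⁅y⁆⇒x≡y ℓ v∈) refl v~a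

    initial : Σ Chain (Tracks 0)
    initial with any? (λ a → adj ℓ a Bool.≟ true)
    ... | no isolated = emptyChain ℓ , λ a a≢ℓ →
          (λ a∈ → ⊥-elim (isolated (a , stage0 a a≢ℓ a∈))) , λ { (_ , () , _) }
    ... | yes (b , ℓ~b) = single , tracks
      where
      single : Chain
      single = record
        { k = 1 ; f = λ _ → b ; inA = λ _ _ b≡ℓ → adj⇒≢ ℓ~b (sym b≡ℓ)
        ; dist = λ { zero zero _ _ _ → refl ; (suc _) _ (s≤s ()) _ _ ; zero (suc _) _ (s≤s ()) _ }
        ; cons = λ { _ (s≤s ()) } ; nbr = λ { _ (s≤s ()) }
        ; entry = λ _ → (λ x z x≡ℓ _ x~z → ℓ-deg≤1 z b (adj-cong x≡ℓ refl x~z) ℓ~b) , (ℓ , refl , ℓ~b) }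
      tracks : Tracks 0 single
      tracks a a≢ℓ = (λ a∈ → 0 , s≤s z≤n , ℓ-deg≤1 b a ℓ~b (stage0 a a≢ℓ a∈)) ,
                     λ { (zero , _ , b≡a) → ℓ , x∈⁅x⁆ ℓ , inj₂ (adj-cong refl b≡a ℓ~b)
                       ; (suc _ , s≤s () , _) }

    path : IsPDS G ⁅ ℓ ⁆ → IsPath G
    path pds with pdsStage ⁅ ℓ ⁆ pds
    ... | i , all with tracksAt (proj₁ initial) (proj₂ initial) i
    ...   | c , tr = listing⇒path (k c) g cover g-inj consecutive gaps
      where
      g : ℕ → Fin n
      g zero    = ℓ
      g (suc m) = f c m

      cover : ∀ v → ∃ λ m → m ≤ k c × g m ≡ v
      cover v with v ≟ᶠ ℓ
      ... | yes v≡ℓ = 0 , z≤n , sym v≡ℓ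
      ... | no v≢ℓ with proj₁ (tr v v≢ℓ) (all v)
      ...   | j , j<k , fj≡v = suc j , j<k , fj≡v

      g-inj : ∀ a b → a ≤ k c → b ≤ k c → g a ≡ g b → a ≡ b
      g-inj zero    zero    _   _   _ = refl
      g-inj zero    (suc b) _   b<k e = ⊥-elim (inA c b b<k (sym e))
      g-inj (suc a) zero    a<k _   e = ⊥-elim (inA c a a<k e)
      g-inj (suc a) (suc b) a<k b<k e = cong suc (dist c a b a<k b<k e)

      consecutive : ∀ a → suc a ≤ k c → adj (g a) (g (suc a)) ≡ true
      consecutive zero    0<k   = let (_ , x , x≡ℓ , x~f0) = entry c 0<k in adj-cong x≡ℓ refl x~f0
      consecutive (suc a) a+1<k = cons c a a+1<k

      gaps : ∀ a b → b ≤ k c → suc a < b → adj (g a) (g b) ≢ true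
      gaps zero    (suc b) b<k (s≤s 0<b) ℓ~fb =
        ℕ.<⇒≢ 0<b (sym (dist c b 0 b<k 0<k (proj₁ (entry c 0<k) ℓ (f c b) refl (inA c b b<k) ℓ~fb)))
        where 0<k = ℕ.<-trans 0<b b<k
      gaps (suc a) (suc b) b<k (s≤s a+1<b) = induced c a b a+1<b b<k

  -- If a vertex u is separated from w by removing a set X of at most one
  -- vertex, and {w} power dominates G, then G has a vertex of degree at most
  -- one: the component of u in G - X is a region with gate X that is
  -- unobserved at stage 0.
  module Separation (X : Subset n) (∣X∣≤1 : ∣ X ∣ ≤ 1) {u w : Fin n} (u∉X : u ∉ X) (w∉X : w ∉ X)
                    (separated : ¬ WalkAvoiding G X u w) where
    open Walks X

    closed : ∀ a z → Walk u a → adj a z ≡ true → Walk u z ⊎ z ∈ X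
    closed a z u⇝a a~z with z ∈? X
    ... | yes z∈X = inj₂ z∈X
    ... | no z∉X  = inj₁ (snoc u⇝a a~z z∉X)

    open ForcingChain ⁅ w ⁆ (_∈ X) (Walk u) (walk? u) closed (λ x y → ∣X∣≤1⇒unique X ∣X∣≤1)

    unobserved : Tracks 0 (emptyChain w)
    unobserved a u⇝a = (λ a∈ → ⊥-elim (notNearW a∈)) , λ { (_ , () , _) }
      where
      notNearW : ¬ 𝒫 G ⁅ w ⁆ 0 a
      notNearW (v , v∈ , inj₁ a≡v) = separated (subst (Walk u) (trans a≡v (x∈⁅y⁆⇒x≡y w v∈)) u⇝a)
      notNearW (v , v∈ , inj₂ v~a) with closed a w u⇝a (adj-sym (adj-cong (x∈⁅y⁆⇒x≡y w v∈) refl v~a))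
      ... | inj₁ u⇝w = separated u⇝w
      ... | inj₂ w∈X = w∉X w∈X

    lowDegree : IsPDS G ⁅ w ⁆ → ∃ Deg≤1
    lowDegree pds = lowDegreeVertex (emptyChain w) unobserved pds u (here u∉X)

  cycleThrough : ∀ {y p q} → p ≢ q → adj y p ≡ true → adj y q ≡ true →
                 Walks.SimplePath ⁅ y ⁆ p q → HasCycle G
  cycleThrough {y} {p} {q} p≢q y~p y~q sp = close L refl
    where
    open Walks.SimplePath sp

    h : ℕ → Fin n
    h zero    = y
    h (suc a) = f a

    h-inj : ∀ a b → a ≤ suc L → b ≤ suc L → h a ≡ h b → a ≡ b
    h-inj zero    zero    _         _         _ = refl
    h-inj zero    (suc b) _         (s≤s b≤L) e = ⊥-elim (out b b≤L (subst (_∈ ⁅ y ⁆) e (x∈⁅x⁆ y)))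
    h-inj (suc a) zero    (s≤s a≤L) _         e = ⊥-elim (out a a≤L (subst (_∈ ⁅ y ⁆) (sym e) (x∈⁅x⁆ y)))
    h-inj (suc a) (suc b) (s≤s a≤L) (s≤s b≤L) e = cong suc (inj a b a≤L b≤L e)

    h-adj : ∀ a → a < suc L → adj (h a) (h (suc a)) ≡ true
    h-adj zero    _         = adj-cong refl (sym f0) y~p
    h-adj (suc a) (s≤s a<L) = adjs a a<L

    close : ∀ m → L ≡ m → HasCycle G
    close zero    L≡0   = ⊥-elim (p≢q (trans (sym f0) (trans (cong f (sym L≡0)) fL)))
    close (suc m) L≡m+1 = m , c , c-inj , c-adj
      where
      c : Fin (suc (suc (suc m))) → Fin n
      c i = h (toℕ i)

      bound : ∀ (i : Fin (suc (suc (suc m)))) → toℕ i ≤ suc L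
      bound i = subst (λ l → toℕ i ≤ suc l) (sym L≡m+1) (s≤s⁻¹ (toℕ<n i))

      c-inj : ∀ {i j} → c i ≡ c j → i ≡ j
      c-inj {i} {j} e = toℕ-injective (h-inj _ _ (bound i) (bound j) e)

      c-adj : ∀ i j → (suc (toℕ i) ≡ toℕ j) ⊎ ((toℕ i ≡ suc (suc m)) × (toℕ j ≡ 0)) →
              adj (c i) (c j) ≡ true
      c-adj i j (inj₁ i+1≡j) =
        adj-cong refl (cong h i+1≡j) (h-adj (toℕ i) (subst (_≤ suc L) (sym i+1≡j) (bound j)))
      c-adj i j (inj₂ (i≡L+1 , j≡0)) =
        adj-cong (sym (trans (cong h i≡L+1) (trans (cong f (sym L≡m+1)) fL))) (sym (cong h j≡0)) (adj-sym y~q)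

  module NoFailedSets (γ̄ₚ≡0 : FailedPowerDomNumber G 0) (notPath : ¬ IsPath G) where
    singletonPDS : ∀ v → ¬ ¬ IsPDS G ⁅ v ⁆
    singletonPDS v fails with subst (_≤ 0) (∣⁅x⁆∣≡1 v) (proj₂ γ̄ₚ≡0 ⁅ v ⁆ fails)
    ... | ()

    noLowDegree : ∀ y → ¬ Deg≤1 y
    noLowDegree y deg≤1 = singletonPDS y λ pds → notPath (LeafPath.path y deg≤1 pds)

    twoNeighbours : ∀ y → ∃ λ p → ∃ λ q → p ≢ q × adj y p ≡ true × adj y q ≡ true
    twoNeighbours y with twoNeighbours? y
    ... | inj₁ two   = two
    ... | inj₂ deg≤1 = ⊥-elim (noLowDegree y deg≤1)

    connectedAfterRemoving≤1 : ∀ X → ∣ X ∣ ≤ 1 → ∀ u w → u ∉ X → w ∉ X → WalkAvoiding G X u w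
    connectedAfterRemoving≤1 X ∣X∣≤1 u w u∉X w∉X with Walks.walk? X u w
    ... | yes u⇝w      = u⇝w
    ... | no separated = ⊥-elim (singletonPDS w λ pds →
            let (y , deg≤1) = Separation.lowDegree X ∣X∣≤1 u∉X w∉X separated pds in noLowDegree y deg≤1)

    twoOutside : Fin n → ∀ X → ∣ X ∣ ≤ 1 → Σ (Fin n) λ u → Σ (Fin n) λ v → u ∉ X × v ∉ X × u ≢ v
    twoOutside y X ∣X∣≤1 =
      let (p , q , p≢q , y~p , y~q) = twoNeighbours y in
      twoOfThreeOutside X ∣X∣≤1 (adj⇒≢ y~p) (adj⇒≢ y~q) p≢q

    -- any vertex lies on a cycle through its two neighbours
    notTree : Fin n → ¬ IsTree G
    notTree y (_ , acyclic) =
      let (p , q , p≢q , y~p , y~q) = twoNeighbours y in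
      acyclic (cycleThrough p≢q y~p y~q (Walks.simplify ⁅ y ⁆
        (connectedAfterRemoving≤1 ⁅ y ⁆ (ℕ.≤-reflexive (∣⁅x⁆∣≡1 y)) p q (notY y~p) (notY y~q))))
      where
      notY : ∀ {z} → adj y z ≡ true → z ∉ ⁅ y ⁆
      notY y~z z∈ = adj⇒≢ y~z (sym (x∈⁅y⁆⇒x≡y y z∈))

-- A graph with a failed power dominating set has a vertex, since on no
-- vertices every set power dominates.
vertexOfFailed : ∀ {n} (G : Graph n) (S : Subset n) → IsFPDS G S → Fin n
vertexOfFailed {zero}  G S fails = ⊥-elim (fails λ ())
vertexOfFailed {suc n} G S fails = fzero

corollary1 : ∀ {n : ℕ} (G : Graph n) → FailedPowerDomNumber G 0 → ¬ IsPath G →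
    KappaAtLeast G 2 × ¬ IsTree G
corollary1 {n} G γ̄ₚ≡0 notPath = κ≥2 , notTree v
  where
  open GraphTheory.NoFailedSets G γ̄ₚ≡0 notPath
  v : Fin n
  v = vertexOfFailed G (proj₁ (proj₁ γ̄ₚ≡0)) (proj₁ (proj₂ (proj₁ γ̄ₚ≡0)))
  κ≥2 : KappaAtLeast G 2
  κ≥2 X ∣X∣<2 = twoOutside v X (s≤s⁻¹ ∣X∣<2) , λ u w → connectedAfterRemoving≤1 X (s≤s⁻¹ ∣X∣<2) u w
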